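{- Let $(T,L)$ be a shadow-complete TAP instance on a $k$-wide tree $T=(V,E)$ with root $r$ and principal subtrees $T_i=(V_i,E_i)$, $i\in[q]$. For each $i\in[q]$ let $L_i=L_i^{R_i}$ for some $R_i\in\Lambda_i$. Call a vertex $u\in V_i$ active if some cross-link in $L_i$ has $u$ as an endpoint, and denote this (unique) cross-link by $\ell_u$. Let $M\subseteq L_{\mathrm{cross}}$ be a matching among active vertices (i.e., a set of cross-links, pairwise vertex-disjoint, whose endpoints are all active), and for each $i$ let $L_i(M)$ be the set of all $\ell_u\in L_i$ with $u\in V_i$ an endpoint of a link in $M$. Then $$\mathcal{B}:=\Big(\bigcup_{i=1}^q \big(L_i\setminus L_i(M)\big)\Big)\cup M$$ is a feasible solution of the TAP instance $(T,L)$.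
   Context: TAP instance $(T,L)$: tree $T=(V,E)$, links $L\subseteq\binom V2$; $P_\ell$ is the edge set of the path between the endpoints of $\ell$; feasible solution $U\subseteq L$ with $\bigcup_{\ell\in U}P_\ell=E$. $T$ is $k$-wide with root $r$ if each principal subtree (the subtree formed by $r$, a child $u$ of $r$ and all descendants of $u$) has at most $k$ leaves; the principal subtrees are $T_i=(V_i,E_i)$, $i\in[q]$ (each contains $r$). Cross-links $L_{\mathrm{cross}}$: links whose endpoints are both $\neq r$ and lie in different principal subtrees. Shadow-complete: for every $\ell\in L$ and distinct vertices $u,v$ on $P_\ell$, $\{u,v\}\in L$ (a shadow of $\ell$). Two links $\ell_1,\ell_2$ are shadow-minimal if there is no shadow $s$ (different from the link itself) of one of them, say $\ell_1$, with $P_{\ell_1}\cup P_{\ell_2}=P_s\cup P_{\ell_2}$; a link set is shadow-minimal if pairwise so. For $F\subseteq E$, $\mathrm{cov}(F)$ is the set of links $\ell$ with $P_\ell\cap F\ne\emptyset$. $\Lambda_i$ is the family of all shadow-minimal sets of cross-links each having an endpoint in $V_i$. For $R\in\Lambda_i$, $C(i,R)\subseteq L$ is a minimum-cardinality set of links with both endpoints in $V_i$ such that $R\cup C(i,R)$ is shadow-minimal and covers $E_i$, and $L_i^R:=R\cup C(i,R)$. -}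

module Defs where

open import Data.Nat using (ℕ; zero; suc; _+_; _≤_)
open import Data.Fin using (Fin) renaming (_<_ to _<ᶠ_)
open import Data.Fin.Properties using (_<?_)
open import Data.Bool using (Bool; true; false; if_then_else_)
open import Data.List using (List; []; _∷_; length; concatMap; map; allFin)
open import Data.Nat.ListAction using (sum)
open import Data.List.Membership.Propositional using (_∈_)
open import Data.Product using (Σ; Σ-syntax; _×_; _,_)
open import Data.Sum using (_⊎_)
open import Relation.Nullary using (¬_; yes; no)
open import Relation.Binary.PropositionalEquality using (_≡_; _≢_)
open import Function.Bundles using (_⇔_)

data Anc {n : ℕ} (p : Fin n → Fin n) (a : Fin n) : Fin n → Set where
  self : Anc p a a
  up   : ∀ {v} → Anc p a (p v) → Anc p a v

-- Every vertex
-- reaches the root by following parents (so there are no cycles).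
-- The edge set E consists of the edges {e, parent e} for e ≢ root;
-- such an edge is identified with its lower endpoint e.
record RTree (n : ℕ) : Set where
  field
    root        : Fin n
    parent      : Fin n → Fin n
    parent-root : parent root ≡ root
    reach       : ∀ v → Anc parent root v

-- Links: unordered pairs {a, b} of distinct vertices, normalised a < b.

record Link (n : ℕ) : Set where
  constructor link
  field
    a   : Fin n
    b   : Fin n
    a<b : a <ᶠ b

open Link public

LinkSet : ℕ → Set
LinkSet n = Link n → Bool

_∈ₗ_ : ∀ {n} → Link n → LinkSet n → Set
ℓ ∈ₗ S = S ℓ ≡ true

allLinks : (n : ℕ) → List (Link n)
allLinks n = concatMap (λ x → concatMap (λ y → f x y) (allFin n)) (allFin n)
  where
  f : Fin n → Fin n → List (Link n)
  f x y with x <? y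
  ... | yes p = link x y p ∷ []
  ... | no _  = []

card : ∀ {n} → LinkSet n → ℕ
card {n} S = sum (map (λ ℓ → if S ℓ then 1 else 0) (allLinks n))

Endpoint : ∀ {n} → Fin n → Link n → Set
Endpoint u ℓ = u ≡ a ℓ ⊎ u ≡ b ℓ

module _ {n : ℕ} (T : RTree n) where
  open RTree T

  IsEdge : Fin n → Set
  IsEdge e = e ≢ root

  OnPathUV : Fin n → Fin n → Fin n → Set
  OnPathUV u v e = (Anc parent e u × ¬ Anc parent e v) ⊎ (¬ Anc parent e u × Anc parent e v)

  P : Link n → Fin n → Set
  P ℓ e = OnPathUV (a ℓ) (b ℓ) e

  VOnPath : Link n → Fin n → Set
  VOnPath ℓ w = w ≡ a ℓ ⊎ (Σ[ e ∈ Fin n ] (P ℓ e × (w ≡ e ⊎ w ≡ parent e)))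

  IsShadow : Link n → Link n → Set
  IsShadow s ℓ = VOnPath ℓ (a s) × VOnPath ℓ (b s)

  ShadowComplete : LinkSet n → Set
  ShadowComplete L = ∀ ℓ → ℓ ∈ₗ L → ∀ s → IsShadow s ℓ → s ∈ₗ L

  SameUnion : Link n → Link n → Link n → Set
  SameUnion ℓ₁ s ℓ₂ = ∀ e → (P ℓ₁ e ⊎ P ℓ₂ e) ⇔ (P s e ⊎ P ℓ₂ e)

  ShadowMinPair : Link n → Link n → Set
  ShadowMinPair ℓ₁ ℓ₂ =
    (∀ s → IsShadow s ℓ₁ → s ≢ ℓ₁ → ¬ SameUnion ℓ₁ s ℓ₂) ×
    (∀ s → IsShadow s ℓ₂ → s ≢ ℓ₂ → ¬ SameUnion ℓ₂ s ℓ₁)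

  ShadowMinimal : (Link n → Set) → Set
  ShadowMinimal S = ∀ ℓ₁ ℓ₂ → S ℓ₁ → S ℓ₂ → ℓ₁ ≢ ℓ₂ → ShadowMinPair ℓ₁ ℓ₂

  -- c is a child of the root; principal subtrees are indexed by such c
  IsChild : Fin n → Set
  IsChild c = c ≢ root × parent c ≡ root

  InV : Fin n → Fin n → Set
  InV c w = w ≡ root ⊎ Anc parent c w

  InE : Fin n → Fin n → Set
  InE c e = Anc parent c e

  IsLeaf : Fin n → Set
  IsLeaf w = w ≢ root × (∀ x → parent x ≢ w)

  KWide : ℕ → Set
  KWide k = ∀ c → IsChild c →
    Σ[ xs ∈ List (Fin n) ] (length xs ≤ k × (∀ w → Anc parent c w → IsLeaf w → w ∈ xs))

  Cross : Link n → Set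
  Cross ℓ = a ℓ ≢ root × b ℓ ≢ root ×
            (∀ c → IsChild c → ¬ (InV c (a ℓ) × InV c (b ℓ)))

  Covers : (Link n → Set) → (Fin n → Set) → Set
  Covers S F = ∀ e → F e → Σ[ ℓ ∈ Link n ] (S ℓ × P ℓ e)

  InΛ : LinkSet n → Fin n → LinkSet n → Set
  InΛ L c R =
    (∀ ℓ → ℓ ∈ₗ R → ℓ ∈ₗ L × Cross ℓ × (InV c (a ℓ) ⊎ InV c (b ℓ))) ×
    ShadowMinimal (λ ℓ → ℓ ∈ₗ R)

  ValidC : LinkSet n → Fin n → LinkSet n → LinkSet n → Set
  ValidC L c R C =
    (∀ ℓ → ℓ ∈ₗ C → ℓ ∈ₗ L × InV c (a ℓ) × InV c (b ℓ)) ×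
    ShadowMinimal (λ ℓ → ℓ ∈ₗ R ⊎ ℓ ∈ₗ C) ×
    Covers (λ ℓ → ℓ ∈ₗ R ⊎ ℓ ∈ₗ C) (InE c)

  IsC : LinkSet n → Fin n → LinkSet n → LinkSet n → Set
  IsC L c R C = ValidC L c R C × (∀ C' → ValidC L c R C' → card C ≤ card C')

  Feasible : LinkSet n → (Link n → Set) → Set
  Feasible L U = (∀ ℓ → U ℓ → ℓ ∈ₗ L) × (∀ e → IsEdge e → Σ[ ℓ ∈ Link n ] (U ℓ × P ℓ e))

  module _ (R C : Fin n → LinkSet n) where

    -- L_c = R_c ∪ C(c, R_c)
    Li : Fin n → Link n → Set
    Li c ℓ = ℓ ∈ₗ R c ⊎ ℓ ∈ₗ C c

    Active : Fin n → Set
    Active u = Σ[ c ∈ Fin n ] (IsChild c × InV c u ×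
                 Σ[ ℓ ∈ Link n ] (Li c ℓ × Cross ℓ × Endpoint u ℓ))

    Matching : LinkSet n → LinkSet n → Set
    Matching L M =
      (∀ ℓ → ℓ ∈ₗ M → ℓ ∈ₗ L × Cross ℓ × Active (a ℓ) × Active (b ℓ)) ×
      (∀ ℓ₁ ℓ₂ → ℓ₁ ∈ₗ M → ℓ₂ ∈ₗ M → ℓ₁ ≢ ℓ₂ → ∀ u → Endpoint u ℓ₁ → ¬ Endpoint u ℓ₂)

    LiM : LinkSet n → Fin n → Link n → Set
    LiM M c ℓ = Li c ℓ × Cross ℓ ×
      Σ[ u ∈ Fin n ] (InV c u × Endpoint u ℓ × Σ[ m ∈ Link n ] (m ∈ₗ M × Endpoint u m))

    𝓑 : LinkSet n → Link n → Set
    𝓑 M ℓ = (Σ[ c ∈ Fin n ] (IsChild c × Li c ℓ × ¬ LiM M c ℓ)) ⊎ ℓ ∈ₗ M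

-- Every edge e of a principal subtree T_c is covered by a link ℓ ∈ L_c through an
-- endpoint u of ℓ lying below e.  If u is matched by some m ∈ M, then m is a
-- cross-link leaving T_c from below e, so m covers e.  Otherwise ℓ ∉ L_c(M): a
-- cross-link has only one endpoint in V_c, so the only candidate witness is u.
-- Hence ℓ itself survives in 𝓑.
module Submission where

open import Defs
open import Data.Nat using (ℕ)
open import Data.Fin using (Fin) renaming (_<_ to _<ᶠ_)
open import Data.Fin.Properties using (_≟_; _<?_; any?; <-irrelevant)
import Data.Bool.Properties as Bool
open import Data.Product using (_×_; Σ; Σ-syntax; ∃; _,_; proj₁; proj₂)
open import Data.Sum using (_⊎_; inj₁; inj₂)
open import Data.Empty using (⊥-elim)
open import Function using (_∘_)
open import Relation.Nullary using (¬_; Dec; yes; no)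
open import Relation.Nullary.Decidable using (map′; _×-dec_; _⊎-dec_)
open import Relation.Binary.PropositionalEquality using (_≡_; refl; subst)

anc-trans : ∀ {n} {p : Fin n → Fin n} {x y z} → Anc p x y → Anc p y z → Anc p x z
anc-trans x≤y self      = x≤y
anc-trans x≤y (up y≤pz) = up (anc-trans x≤y y≤pz)

any-link? : ∀ {n} {Q : Link n → Set} → (∀ ℓ → Dec (Q ℓ)) → Dec (∃ Q)
any-link? {n} {Q} Q? =
  map′ (λ (x , y , x<y , q) → link x y x<y , q)
       (λ (link x y x<y , q) → x , y , x<y , q)
       (any? λ x → any? λ y → link? x y)
  where
  link? : ∀ x y → Dec (Σ (x <ᶠ y) (Q ∘ link x y))
  link? x y with x <? y
  ... | no x≮y  = no (x≮y ∘ proj₁)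
  ... | yes x<y = map′ (x<y ,_)
                       (λ (p , q) → subst (Q ∘ link x y) (<-irrelevant p x<y) q)
                       (Q? (link x y x<y))

endpoint? : ∀ {n} (u : Fin n) (ℓ : Link n) → Dec (Endpoint u ℓ)
endpoint? u ℓ = (u ≟ a ℓ) ⊎-dec (u ≟ b ℓ)

matched? : ∀ {n} (M : LinkSet n) (u : Fin n) → Dec (Σ[ m ∈ Link n ] (m ∈ₗ M × Endpoint u m))
matched? M u = any-link? λ m → (M m Bool.≟ _) ×-dec endpoint? u m

module _ {n : ℕ} (T : RTree n) where
  open RTree T

  principal-subtree : ∀ e → IsEdge T e → Σ[ c ∈ Fin n ] (IsChild T c × InE T c e)
  principal-subtree e = below-root e (reach e)
    where
    below-root : ∀ e → Anc parent root e → IsEdge T e → Σ[ c ∈ Fin n ] (IsChild T c × InE T c e)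
    below-root e self     e≢r = ⊥-elim (e≢r refl)
    below-root e (up r≤pe) e≢r with parent e ≟ root
    ... | yes pe≡r = e , (e≢r , pe≡r) , self
    ... | no pe≢r  with below-root (parent e) r≤pe pe≢r
    ...   | c , c-child , c≤pe = c , c-child , up c≤pe

  path-edge-below-endpoint : ∀ {ℓ e} → P T ℓ e → Σ[ u ∈ Fin n ] (Endpoint u ℓ × Anc parent e u)
  path-edge-below-endpoint (inj₁ (e≤a , _)) = _ , inj₁ refl , e≤a
  path-edge-below-endpoint (inj₂ (_ , e≤b)) = _ , inj₂ refl , e≤b

  cross-endpoints-in-subtree-≡ : ∀ {c ℓ u w} → Cross T ℓ → IsChild T c →
    Endpoint u ℓ → Endpoint w ℓ → InV T c u → InV T c w → u ≡ w
  cross-endpoints-in-subtree-≡ _            _       (inj₁ refl) (inj₁ refl) _   _   = refl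
  cross-endpoints-in-subtree-≡ _            _       (inj₂ refl) (inj₂ refl) _   _   = refl
  cross-endpoints-in-subtree-≡ (_ , _ , ×c) c-child (inj₁ refl) (inj₂ refl) u∈V w∈V =
    ⊥-elim (×c _ c-child (u∈V , w∈V))
  cross-endpoints-in-subtree-≡ (_ , _ , ×c) c-child (inj₂ refl) (inj₁ refl) u∈V w∈V =
    ⊥-elim (×c _ c-child (w∈V , u∈V))

  cross-link-covers-below : ∀ {c e u m} → IsChild T c → InE T c e → Anc parent e u →
    Cross T m → Endpoint u m → P T m e
  cross-link-covers-below c-child c≤e e≤u (_ , _ , ×c) (inj₁ refl) =
    inj₁ (e≤u , λ e≤b → ×c _ c-child (inj₂ (anc-trans c≤e e≤u) , inj₂ (anc-trans c≤e e≤b)))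
  cross-link-covers-below c-child c≤e e≤u (_ , _ , ×c) (inj₂ refl) =
    inj₂ ((λ e≤a → ×c _ c-child (inj₂ (anc-trans c≤e e≤a) , inj₂ (anc-trans c≤e e≤u))) , e≤u)

  module _ (R C : Fin n → LinkSet n) (M : LinkSet n)
           (M-cross : ∀ m → m ∈ₗ M → Cross T m) where

    matched-or-kept : ∀ {c e ℓ} → IsChild T c → InE T c e → Li T R C c ℓ → P T ℓ e →
      Σ[ ℓ′ ∈ Link n ] (𝓑 T R C M ℓ′ × P T ℓ′ e)
    matched-or-kept {c} {ℓ = ℓ} c-child c≤e ℓ∈Lc ℓ-covers
      with path-edge-below-endpoint {ℓ} ℓ-covers
    ... | u , u∈ℓ , e≤u with matched? M u
    ...   | yes (m , m∈M , u∈m) =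
            m , inj₂ m∈M , cross-link-covers-below {c} {m = m} c-child c≤e e≤u (M-cross m m∈M) u∈m
    ...   | no u-unmatched = ℓ , inj₁ (c , c-child , ℓ∈Lc , ℓ∉LcM) , ℓ-covers
      where
      ℓ∉LcM : ¬ LiM T R C M c ℓ
      ℓ∉LcM (_ , ℓ-cross , w , w∈V , w∈ℓ , w-matched)
        with cross-endpoints-in-subtree-≡ {c} {ℓ} ℓ-cross c-child u∈ℓ w∈ℓ (inj₂ (anc-trans c≤e e≤u)) w∈V
      ... | refl = u-unmatched w-matched

proposition1 : ∀ {n : ℕ} (T : RTree n) (k : ℕ) (L : LinkSet n) →
    KWide T k → ShadowComplete T L →
    (R C : Fin n → LinkSet n) →
    (∀ c → IsChild T c → InΛ T L c (R c) × IsC T L c (R c) (C c)) →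
    (M : LinkSet n) → Matching T R C L M →
    Feasible T L (𝓑 T R C M)
proposition1 {n} T _ L _ _ R C Li-props M (M-props , _) = 𝓑⊆L , 𝓑-covers
  where
  R⊆L : ∀ c → IsChild T c → ∀ ℓ → ℓ ∈ₗ R c → ℓ ∈ₗ L
  R⊆L c c-child ℓ = proj₁ ∘ proj₁ (proj₁ (Li-props c c-child)) ℓ

  C⊆L : ∀ c → IsChild T c → ∀ ℓ → ℓ ∈ₗ C c → ℓ ∈ₗ L
  C⊆L c c-child ℓ = proj₁ ∘ proj₁ (proj₁ (proj₂ (Li-props c c-child))) ℓ

  Li-covers-E : ∀ c → IsChild T c → Covers T (Li T R C c) (InE T c)
  Li-covers-E c c-child = proj₂ (proj₂ (proj₁ (proj₂ (Li-props c c-child))))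

  𝓑⊆L : ∀ ℓ → 𝓑 T R C M ℓ → ℓ ∈ₗ L
  𝓑⊆L ℓ (inj₁ (c , c-child , inj₁ ℓ∈R , _)) = R⊆L c c-child ℓ ℓ∈R
  𝓑⊆L ℓ (inj₁ (c , c-child , inj₂ ℓ∈C , _)) = C⊆L c c-child ℓ ℓ∈C
  𝓑⊆L ℓ (inj₂ ℓ∈M)                         = proj₁ (M-props ℓ ℓ∈M)

  𝓑-covers : ∀ e → IsEdge T e → Σ[ ℓ ∈ Link n ] (𝓑 T R C M ℓ × P T ℓ e)
  𝓑-covers e e≢r with principal-subtree T e e≢r
  ... | c , c-child , c≤e with Li-covers-E c c-child e c≤e
  ...   | ℓ , ℓ∈Lc , ℓ-covers =
          matched-or-kept T R C M (λ m → proj₁ ∘ proj₂ ∘ M-props m) c-child c≤e ℓ∈Lc ℓ-covers
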